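{- Let $n\ge 2$ and let $R$ be the $n\times n$ matrix with $(i,j)$ entry $\binom{i-1}{n-j}$, $1\le i,j\le n$. Let $b_{i,j}$ and $c_{i,j}$ denote the $(i,j)$ entries of $R^2$ and $R^3$ respectively. Then for all $1\le i\le n-1$ and $1\le j\le n$, \[ b_{i+1,j}=b_{i,j}-\sum_{k=1}^{j-1}(-1)^k b_{i,j-k},\qquad c_{i+1,j}=2c_{i,j}+\sum_{k=1}^{j-1}(-1)^k2^{k-1}c_{i,j-k}. \]
   Context: Convention: $\binom{m}{k}=0$ if $k<0$ or $k>m$; an empty sum is $0$. -}

module Defs where

open import Data.Nat using (ℕ; zero; suc; _∸_)
open import Data.Nat.Combinatorics using (_C_)
open import Data.Integer using (ℤ; +_; _+_; _*_)

-- Matrices with 1-based indices, represented as functions ℕ → ℕ → ℤ;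
-- only entries with indices in 1..n are meaningful.

sumFrom1 : ℕ → (ℕ → ℤ) → ℤ
sumFrom1 zero    f = + 0
sumFrom1 (suc m) f = sumFrom1 m f + f (suc m)

-- The n×n matrix R with (i,j) entry binom(i-1, n-j), 1 ≤ i,j ≤ n.
-- (For 1 ≤ j ≤ n, n ∸ j = n - j, so no truncation occurs.)
Rmat : ℕ → ℕ → ℕ → ℤ
Rmat n i j = + ((i ∸ 1) C (n ∸ j))

matMul : ℕ → (ℕ → ℕ → ℤ) → (ℕ → ℕ → ℤ) → ℕ → ℕ → ℤ
matMul n A B i j = sumFrom1 n (λ k → A i k * B k j)

bEntry : ℕ → ℕ → ℕ → ℤ
bEntry n = matMul n (Rmat n) (Rmat n)

cEntry : ℕ → ℕ → ℕ → ℤ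
cEntry n = matMul n (bEntry n) (Rmat n)

-- Write b, c for rows i of R², R³ and d = b(i+1) − b(i), e = c(i+1) − c(i).
-- By Pascal's rule, row k+1 of R is row k plus row k shifted one column to
-- the left (the last column is constantly 1), and the first column of R is the
-- last unit vector. Hence R(i+1,·) − R(i,·) is row i shifted, which gives
-- d(j) + d(j+1) = b(j) with d(1) = 0; multiplying by R once more gives
-- 2e(j) + e(j+1) = c(j) + c(j+1) with e(1) = c(1). The two formulas are the
-- solutions of these first-order linear recurrences.
module Submission where

open import Defs
open import Data.Nat using (ℕ; suc; _≤_; _∸_; _^_)
open import Data.Integer using (ℤ; +_; _+_; _-_; _*_; -1ℤ)
open import Data.Integer using () renaming (_^_ to _^ℤ_)
open import Data.Product using (_×_)
open import Relation.Binary.PropositionalEquality using (_≡_)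

open import Data.Nat using (zero; _<_; z≤n; s≤s)
import Data.Nat.Properties as ℕ
open import Data.Nat.Combinatorics using (_C_; nCk+nC[k+1]≡[n+1]C[k+1]; k>n⇒nCk≡0; nCn≡1)
open import Data.Integer using (-_)
import Data.Integer.Properties as ℤ
open import Data.Integer.Tactic.RingSolver using (solve-∀)
open import Data.Product using (_,_)
open import Relation.Binary.PropositionalEquality using (refl; sym; trans; cong; cong₂)
open Relation.Binary.PropositionalEquality.≡-Reasoning

sumFrom1-cong : ∀ m {f g : ℕ → ℤ} → (∀ k → 1 ≤ k → k ≤ m → f k ≡ g k) →
                sumFrom1 m f ≡ sumFrom1 m g
sumFrom1-cong zero    f≡g = refl
sumFrom1-cong (suc m) f≡g =
  cong₂ _+_ (sumFrom1-cong m (λ k 1≤k k≤m → f≡g k 1≤k (ℕ.m≤n⇒m≤1+n k≤m)))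
            (f≡g (suc m) (s≤s z≤n) ℕ.≤-refl)

sumFrom1-zero : ∀ m → sumFrom1 m (λ _ → + 0) ≡ + 0
sumFrom1-zero zero    = refl
sumFrom1-zero (suc m) = cong (_+ + 0) (sumFrom1-zero m)

sumFrom1-+ : ∀ m (f g : ℕ → ℤ) →
             sumFrom1 m (λ k → f k + g k) ≡ sumFrom1 m f + sumFrom1 m g
sumFrom1-+ zero    f g = refl
sumFrom1-+ (suc m) f g = trans (cong (_+ (f (suc m) + g (suc m))) (sumFrom1-+ m f g))
                               (interchange (sumFrom1 m f) (sumFrom1 m g) (f (suc m)) (g (suc m)))
  where
  interchange : ∀ a b c d → (a + b) + (c + d) ≡ (a + c) + (b + d)
  interchange = solve-∀

sumFrom1-minus : ∀ m (f g : ℕ → ℤ) →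
             sumFrom1 m (λ k → f k - g k) ≡ sumFrom1 m f - sumFrom1 m g
sumFrom1-minus zero    f g = refl
sumFrom1-minus (suc m) f g = trans (cong (_+ (f (suc m) - g (suc m))) (sumFrom1-minus m f g))
                               (interchange (sumFrom1 m f) (sumFrom1 m g) (f (suc m)) (g (suc m)))
  where
  interchange : ∀ a b c d → (a - b) + (c - d) ≡ (a + c) - (b + d)
  interchange = solve-∀

*-distribˡ-sumFrom1 : ∀ m (a : ℤ) (f : ℕ → ℤ) →
                      a * sumFrom1 m f ≡ sumFrom1 m (λ k → a * f k)
*-distribˡ-sumFrom1 zero    a f = ℤ.*-zeroʳ a
*-distribˡ-sumFrom1 (suc m) a f =
  trans (ℤ.*-distribˡ-+ a (sumFrom1 m f) (f (suc m)))
        (cong (_+ (a * f (suc m))) (*-distribˡ-sumFrom1 m a f))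

sumFrom1-head : ∀ m (f : ℕ → ℤ) → sumFrom1 (suc m) f ≡ f 1 + sumFrom1 m (λ k → f (suc k))
sumFrom1-head zero    f = trans (ℤ.+-identityˡ (f 1)) (sym (ℤ.+-identityʳ (f 1)))
sumFrom1-head (suc m) f =
  trans (cong (_+ f (suc (suc m))) (sumFrom1-head m f))
        (ℤ.+-assoc (f 1) (sumFrom1 m (λ k → f (suc k))) (f (suc (suc m))))

sumFrom1-shift : ∀ m (f g : ℕ → ℤ) → (∀ k → 1 ≤ k → k ≤ m → f k ≡ g (suc k)) →
                 f (suc m) ≡ + 0 → g 1 ≡ + 0 → sumFrom1 (suc m) f ≡ sumFrom1 (suc m) g
sumFrom1-shift m f g f≡g∘suc f-last≡0 g-first≡0 = begin
  sumFrom1 m f + f (suc m)                    ≡⟨ cong₂ _+_ (sumFrom1-cong m f≡g∘suc) f-last≡0 ⟩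
  sumFrom1 m (λ k → g (suc k)) + + 0          ≡⟨ ℤ.+-identityʳ _ ⟩
  sumFrom1 m (λ k → g (suc k))                ≡⟨ ℤ.+-identityˡ _ ⟨
  + 0 + sumFrom1 m (λ k → g (suc k))          ≡⟨ cong (_+ sumFrom1 m (λ k → g (suc k))) g-first≡0 ⟨
  g 1 + sumFrom1 m (λ k → g (suc k))          ≡⟨ sumFrom1-head m g ⟨
  sumFrom1 (suc m) g                          ∎

first-order-recurrence : ∀ m (r : ℤ) (g x y : ℕ → ℤ) →
  (∀ k → 1 ≤ k → g (suc k) ≡ r * g k) →
  x 1 ≡ + 0 →
  (∀ j → 1 ≤ j → j ≤ m → x (suc j) ≡ g 1 * y j + r * x j) →
  ∀ t → t ≤ m → x (suc t) ≡ sumFrom1 t (λ k → g k * y (suc t ∸ k))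
first-order-recurrence m r g x y g-step x-first x-step zero    _   = x-first
first-order-recurrence m r g x y g-step x-first x-step (suc t) t<m = begin
    x (suc (suc t))
  ≡⟨ x-step (suc t) (s≤s z≤n) t<m ⟩
    g 1 * y (suc t) + r * x (suc t)
  ≡⟨ cong (λ s → g 1 * y (suc t) + r * s)
          (first-order-recurrence m r g x y g-step x-first x-step t (ℕ.<⇒≤ t<m)) ⟩
    g 1 * y (suc t) + r * sumFrom1 t (λ k → g k * y (suc t ∸ k))
  ≡⟨ cong (_+_ (g 1 * y (suc t))) (trans (*-distribˡ-sumFrom1 t r _) (sumFrom1-cong t r*term≡)) ⟩
    g 1 * y (suc t) + sumFrom1 t (λ k → g (suc k) * y (suc t ∸ k))
  ≡⟨ sumFrom1-head t (λ k → g k * y (suc (suc t) ∸ k)) ⟨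
    sumFrom1 (suc t) (λ k → g k * y (suc (suc t) ∸ k))
  ∎
  where
  r*term≡ : ∀ k → 1 ≤ k → k ≤ t → r * (g k * y (suc t ∸ k)) ≡ g (suc k) * y (suc t ∸ k)
  r*term≡ k 1≤k _ = trans (sym (ℤ.*-assoc r (g k) _)) (cong (_* y (suc t ∸ k)) (sym (g-step k 1≤k)))

Rmat-pascal : ∀ n k j → j < n → Rmat n (suc (suc k)) j ≡ Rmat n (suc k) j + Rmat n (suc k) (suc j)
Rmat-pascal (suc n) k j (s≤s j≤n) rewrite ℕ.+-∸-assoc 1 j≤n =
  cong +_ (trans (sym (nCk+nC[k+1]≡[n+1]C[k+1] k (n ∸ j))) (ℕ.+-comm (k C (n ∸ j)) (k C suc (n ∸ j))))

Rmat-last-column : ∀ n k → Rmat n k n ≡ + 1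
Rmat-last-column n k rewrite ℕ.n∸n≡0 n = refl

Rmat-first-column : ∀ n k → k < n → Rmat (suc n) (suc k) 1 ≡ + 0
Rmat-first-column n k k<n = cong +_ (k>n⇒nCk≡0 k<n)

Rmat-corner : ∀ n → Rmat (suc n) (suc n) 1 ≡ + 1
Rmat-corner n = cong +_ (nCn≡1 n)

vecMul : ℕ → (ℕ → ℤ) → (ℕ → ℕ → ℤ) → ℕ → ℤ
vecMul n x A j = sumFrom1 n (λ k → x k * A k j)

vecMul-minus : ∀ n (x y : ℕ → ℤ) A j →
           vecMul n x A j - vecMul n y A j ≡ vecMul n (λ k → x k - y k) A j
vecMul-minus n x y A j =
  trans (sym (sumFrom1-minus n (λ k → x k * A k j) (λ k → y k * A k j)))
        (sumFrom1-cong n (λ k _ _ → *-distribʳ-minus (x k) (y k) (A k j)))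
  where
  *-distribʳ-minus : ∀ a b c → a * c - b * c ≡ (a - b) * c
  *-distribʳ-minus = solve-∀

module _ (n′ : ℕ) where

  private
    n : ℕ
    n = suc n′

    R Rˢ : ℕ → ℕ → ℤ
    R = Rmat n
    Rˢ k = R (suc k)

  vecMul-Rmat-pascal : ∀ x j → j ≤ n′ → vecMul n x R j + vecMul n x R (suc j) ≡ vecMul n x Rˢ j
  vecMul-Rmat-pascal x j j≤n′ =
    trans (sym (sumFrom1-+ n (λ k → x k * R k j) (λ k → x k * R k (suc j))))
          (sumFrom1-cong n pascal)
    where
    pascal : ∀ k → 1 ≤ k → k ≤ n → x k * R k j + x k * R k (suc j) ≡ x k * Rˢ k j
    pascal (suc k) _ _ = trans (sym (ℤ.*-distribˡ-+ (x (suc k)) _ _))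
                               (cong (x (suc k) *_) (sym (Rmat-pascal n k j (s≤s j≤n′))))

  vecMul-Rmat-first-column : ∀ x → vecMul n x R 1 ≡ x n
  vecMul-Rmat-first-column x = begin
    sumFrom1 n′ (λ k → x k * R k 1) + x n * R n 1
      ≡⟨ cong₂ _+_ (sumFrom1-cong n′ below-corner) (cong (x n *_) (Rmat-corner n′)) ⟩
    sumFrom1 n′ (λ _ → + 0) + x n * + 1
      ≡⟨ cong₂ _+_ (sumFrom1-zero n′) (ℤ.*-identityʳ (x n)) ⟩
    + 0 + x n
      ≡⟨ ℤ.+-identityˡ (x n) ⟩
    x n ∎
    where
    below-corner : ∀ k → 1 ≤ k → k ≤ n′ → x k * R k 1 ≡ + 0
    below-corner (suc k) _ k<n′ =
      trans (cong (x (suc k) *_) (Rmat-first-column n′ k k<n′)) (ℤ.*-zeroʳ (x (suc k)))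

  vecMul-Rmat-last-column : ∀ x → vecMul n x R n ≡ vecMul n x Rˢ n
  vecMul-Rmat-last-column x = sumFrom1-cong n λ k _ _ →
    cong (x k *_) (trans (Rmat-last-column n k) (sym (Rmat-last-column n (suc k))))

  module _ (i′ : ℕ) (i<n′ : suc i′ ≤ n′) where

    private
      i : ℕ
      i = suc i′

      b b′ c c′ ρ d e : ℕ → ℤ
      b  = bEntry n i
      b′ = bEntry n (suc i)
      c  = cEntry n i
      c′ = cEntry n (suc i)
      ρ k = R (suc i) k - R i k
      d j = b′ j - b j
      e j = c′ j - c j

    ρ≡shifted-row : ∀ k → k ≤ n′ → ρ k ≡ R i (suc k)
    ρ≡shifted-row k k≤n′ = trans (cong (_- R i k) (Rmat-pascal n i′ k (s≤s k≤n′))) (cancel (R i k) _)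
      where
      cancel : ∀ a b → (a + b) - a ≡ b
      cancel = solve-∀

    ρ-last : ρ n ≡ + 0
    ρ-last rewrite Rmat-last-column n (suc i) | Rmat-last-column n i = refl

    d≡ρR : ∀ j → d j ≡ vecMul n ρ R j
    d≡ρR = vecMul-minus n (R (suc i)) (R i) R

    e≡dR : ∀ j → e j ≡ vecMul n d R j
    e≡dR = vecMul-minus n b′ b R

    ρRˢ≡b : ∀ j → vecMul n ρ Rˢ j ≡ b j
    ρRˢ≡b j = sumFrom1-shift n′ (λ k → ρ k * Rˢ k j) (λ k → R i k * R k j)
      (λ k _ k≤n′ → cong (_* Rˢ k j) (ρ≡shifted-row k k≤n′))
      (trans (cong (_* Rˢ n j) ρ-last) (ℤ.*-zeroˡ (Rˢ n j)))
      (trans (cong (_* R 1 j) (Rmat-first-column n′ i′ i<n′)) (ℤ.*-zeroˡ (R 1 j)))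

    d-first : d 1 ≡ + 0
    d-first = trans (d≡ρR 1) (trans (vecMul-Rmat-first-column ρ) ρ-last)

    d-last : d n ≡ b n
    d-last = trans (d≡ρR n) (trans (vecMul-Rmat-last-column ρ) (ρRˢ≡b n))

    d-adjacent : ∀ j → j ≤ n′ → d j + d (suc j) ≡ b j
    d-adjacent j j≤n′ = begin
      d j + d (suc j)                        ≡⟨ cong₂ _+_ (d≡ρR j) (d≡ρR (suc j)) ⟩
      vecMul n ρ R j + vecMul n ρ R (suc j)  ≡⟨ vecMul-Rmat-pascal ρ j j≤n′ ⟩
      vecMul n ρ Rˢ j                        ≡⟨ ρRˢ≡b j ⟩
      b j                                    ∎

    e-first : e 1 ≡ c 1
    e-first = begin
      e 1                ≡⟨ e≡dR 1 ⟩
      vecMul n d R 1     ≡⟨ vecMul-Rmat-first-column d ⟩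
      d n                ≡⟨ d-last ⟩
      b n                ≡⟨ vecMul-Rmat-first-column b ⟨
      c 1                ∎

    [b-d]Rˢ≡e : ∀ j → vecMul n (λ k → b k - d k) Rˢ j ≡ e j
    [b-d]Rˢ≡e j = trans
      (sumFrom1-shift n′ (λ k → (b k - d k) * Rˢ k j) (λ k → d k * R k j)
        (λ k _ k≤n′ → cong (_* Rˢ k j) (b-d≡d∘suc k k≤n′))
        (trans (cong (λ s → (b n - s) * Rˢ n j) d-last)
               (trans (cong (_* Rˢ n j) (ℤ.+-inverseʳ (b n))) (ℤ.*-zeroˡ (Rˢ n j))))
        (trans (cong (_* R 1 j) d-first) (ℤ.*-zeroˡ (R 1 j))))
      (sym (e≡dR j))
      where
      b-d≡d∘suc : ∀ k → k ≤ n′ → b k - d k ≡ d (suc k)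
      b-d≡d∘suc k k≤n′ = trans (cong (_- d k) (sym (d-adjacent k k≤n′))) (cancel (d k) (d (suc k)))
        where
        cancel : ∀ a b → (a + b) - a ≡ b
        cancel = solve-∀

    e-adjacent : ∀ j → j ≤ n′ → e j + e (suc j) + e j ≡ c j + c (suc j)
    e-adjacent j j≤n′ = begin
      e j + e (suc j) + e j
        ≡⟨ cong₂ _+_ (cong₂ _+_ (e≡dR j) (e≡dR (suc j))) (sym ([b-d]Rˢ≡e j)) ⟩
      vecMul n d R j + vecMul n d R (suc j) + vecMul n (λ k → b k - d k) Rˢ j
        ≡⟨ cong₂ _+_ (vecMul-Rmat-pascal d j j≤n′) (sym (vecMul-minus n b d Rˢ j)) ⟩
      vecMul n d Rˢ j + (vecMul n b Rˢ j - vecMul n d Rˢ j)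
        ≡⟨ cancel (vecMul n d Rˢ j) (vecMul n b Rˢ j) ⟩
      vecMul n b Rˢ j
        ≡⟨ vecMul-Rmat-pascal b j j≤n′ ⟨
      c j + c (suc j) ∎
      where
      cancel : ∀ a b → a + (b - a) ≡ b
      cancel = solve-∀

    bEntry-next-row : ∀ t → t ≤ n′ →
      b′ (suc t) ≡ b (suc t) - sumFrom1 t (λ k → (-1ℤ ^ℤ k) * b (suc t ∸ k))
    bEntry-next-row t t≤n′ = begin
      b′ (suc t)                  ≡⟨ b′≡b-[-d] (b (suc t)) (b′ (suc t)) ⟩
      b (suc t) - (- d (suc t))   ≡⟨ cong (_-_ (b (suc t))) −d≡sum ⟩
      b (suc t) - sumFrom1 t (λ k → (-1ℤ ^ℤ k) * b (suc t ∸ k)) ∎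
      where
      b′≡b-[-d] : ∀ p q → q ≡ p - (- (q - p))
      b′≡b-[-d] = solve-∀
      step : ∀ j → 1 ≤ j → j ≤ n′ → - d (suc j) ≡ -1ℤ * b j + -1ℤ * (- d j)
      step j _ j≤n′ = begin
        - d (suc j)
          ≡⟨ regroup (d j) (d (suc j)) ⟩
        -1ℤ * (d j + d (suc j)) + -1ℤ * (- d j)
          ≡⟨ cong (λ s → -1ℤ * s + -1ℤ * (- d j)) (d-adjacent j j≤n′) ⟩
        -1ℤ * b j + -1ℤ * (- d j) ∎
        where
        regroup : ∀ u v → - v ≡ -1ℤ * (u + v) + -1ℤ * (- u)
        regroup = solve-∀
      −d≡sum : - d (suc t) ≡ sumFrom1 t (λ k → (-1ℤ ^ℤ k) * b (suc t ∸ k))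
      −d≡sum = first-order-recurrence n′ -1ℤ (-1ℤ ^ℤ_) (λ j → - d j) b
                 (λ _ _ → refl) (cong -_ d-first) step t t≤n′

    cEntry-next-row : ∀ t → t ≤ n′ →
      c′ (suc t) ≡ + 2 * c (suc t) + sumFrom1 t (λ k → (-1ℤ ^ℤ k) * (+ (2 ^ (k ∸ 1))) * c (suc t ∸ k))
    cEntry-next-row t t≤n′ = begin
      c′ (suc t)                                 ≡⟨ c′≡2c+[e-c] (c (suc t)) (c′ (suc t)) ⟩
      + 2 * c (suc t) + (e (suc t) - c (suc t))  ≡⟨ cong (_+_ (+ 2 * c (suc t))) e-c≡sum ⟩
      + 2 * c (suc t) + sumFrom1 t (λ k → coefficient k * c (suc t ∸ k)) ∎
      where
      coefficient : ℕ → ℤ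
      coefficient k = (-1ℤ ^ℤ k) * (+ (2 ^ (k ∸ 1)))
      c′≡2c+[e-c] : ∀ p q → q ≡ + 2 * p + ((q - p) - p)
      c′≡2c+[e-c] = solve-∀
      coefficient-step : ∀ k → 1 ≤ k → coefficient (suc k) ≡ (- + 2) * coefficient k
      coefficient-step (suc k) _ =
        trans (cong ((-1ℤ ^ℤ suc (suc k)) *_) (ℤ.pos-* 2 (2 ^ k))) (regroup (-1ℤ ^ℤ suc k) (+ (2 ^ k)))
        where
        regroup : ∀ a p → (-1ℤ * a) * (+ 2 * p) ≡ (- + 2) * (a * p)
        regroup = solve-∀
      step : ∀ j → 1 ≤ j → j ≤ n′ → e (suc j) - c (suc j) ≡ -1ℤ * c j + (- + 2) * (e j - c j)
      step j _ j≤n′ = begin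
        e (suc j) - c (suc j)
          ≡⟨ expand (e j) (e (suc j)) (c (suc j)) ⟩
        (e j + e (suc j) + e j) - c (suc j) - e j - e j
          ≡⟨ cong (λ s → s - c (suc j) - e j - e j) (e-adjacent j j≤n′) ⟩
        (c j + c (suc j)) - c (suc j) - e j - e j
          ≡⟨ collect (e j) (c j) (c (suc j)) ⟩
        -1ℤ * c j + (- + 2) * (e j - c j) ∎
        where
        expand : ∀ u v q → v - q ≡ (u + v + u) - q - u - u
        expand = solve-∀
        collect : ∀ u p q → (p + q) - q - u - u ≡ -1ℤ * p + (- + 2) * (u - p)
        collect = solve-∀
      e-c≡sum : e (suc t) - c (suc t) ≡ sumFrom1 t (λ k → coefficient k * c (suc t ∸ k))
      e-c≡sum = first-order-recurrence n′ (- + 2) coefficient (λ j → e j - c j) c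
                  coefficient-step (trans (cong (_- c 1) e-first) (ℤ.+-inverseʳ (c 1))) step t t≤n′

corollary3 : (n : ℕ) → 2 ≤ n → (i j : ℕ) → 1 ≤ i → i ≤ n ∸ 1 → 1 ≤ j → j ≤ n →
    (bEntry n (suc i) j ≡ bEntry n i j - sumFrom1 (j ∸ 1) (λ k → (-1ℤ ^ℤ k) * bEntry n i (j ∸ k)))
    × (cEntry n (suc i) j ≡ + 2 * cEntry n i j + sumFrom1 (j ∸ 1) (λ k → (-1ℤ ^ℤ k) * (+ (2 ^ (k ∸ 1))) * cEntry n i (j ∸ k)))
corollary3 (suc n′) _ (suc i′) (suc t) _ i<n′ _ (s≤s t≤n′) =
  bEntry-next-row n′ i′ i<n′ t t≤n′ , cEntry-next-row n′ i′ i<n′ t t≤n′
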